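{- $A$--$B$--$A$-paths do not have the edge-Erdős–Pósa property: there is no function $f:\mathbb{N}\to\mathbb{N}$ such that for every positive integer $k$, every finite graph $G$ and all $A,B\subseteq V(G)$, the graph $G$ contains either $k$ pairwise edge-disjoint $A$--$B$--$A$-paths, or an edge set $Z\subseteq E(G)$ with $|Z|\le f(k)$ meeting every $A$--$B$--$A$-path.
   Context: An $A$-path is a path with at least one edge whose two endvertices lie in $A$ and none of whose interior vertices lie in $A$. An $A$--$B$--$A$-path is an $A$-path that contains at least one vertex of $B$. -}

module Defs where

open import Data.Nat using (ℕ; _≤_; _≥_)
open import Data.Bool using (Bool; true; false)
open import Data.Fin using (Fin)
open import Data.Fin.Subset using (Subset; _∈_; _∉_)
open import Data.List using (List; []; _∷_; _++_; length)
open import Data.List.Relation.Unary.All using (All)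
open import Data.List.Relation.Unary.Any using (Any)
open import Data.List.Relation.Unary.Linked using (Linked)
open import Data.List.Relation.Unary.Unique.Propositional using (Unique)
open import Data.List.Membership.Propositional using () renaming (_∈_ to _∈ₗ_)
open import Data.Product using (Σ; _×_; _,_; ∃; ∃-syntax)
open import Data.Sum using (_⊎_)
open import Relation.Binary.PropositionalEquality using (_≡_; _≢_)
open import Relation.Nullary using (¬_)

record Graph : Set where
  field
    n     : ℕ
    adj   : Fin n → Fin n → Bool
    sym   : ∀ u v → adj u v ≡ adj v u
    irrefl : ∀ v → adj v v ≡ false

open Graph public

Vertex : Graph → Set
Vertex G = Fin (n G)

Adj : (G : Graph) → Vertex G → Vertex G → Set
Adj G u v = adj G u v ≡ true

SameEdge : ∀ {V : Set} → V × V → V × V → Set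
SameEdge (a , b) (c , d) = (a ≡ c × b ≡ d) ⊎ (a ≡ d × b ≡ c)

consecutive : ∀ {V : Set} → List V → List (V × V)
consecutive (x ∷ y ∷ xs) = (x , y) ∷ consecutive (y ∷ xs)
consecutive _ = []

record Path (G : Graph) : Set where
  field
    start  : Vertex G
    inner  : List (Vertex G)
    end    : Vertex G
  vertices : List (Vertex G)
  vertices = start ∷ inner ++ end ∷ []
  field
    linked : Linked (Adj G) vertices
    unique : Unique vertices

open Path public

edgesOf : ∀ {G} → Path G → List (Vertex G × Vertex G)
edgesOf P = consecutive (vertices P)

IsAPath : ∀ {G} → Subset (n G) → Path G → Set
IsAPath A P = (start P ∈ A) × (end P ∈ A) × All (_∉ A) (inner P)

IsABAPath : ∀ {G} → Subset (n G) → Subset (n G) → Path G → Set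
IsABAPath A B P = IsAPath A P × Any (_∈ B) (vertices P)

EdgeDisjoint : ∀ {G} → Path G → Path G → Set
EdgeDisjoint P Q = ∀ e f → e ∈ₗ edgesOf P → f ∈ₗ edgesOf Q → ¬ SameEdge e f

HasDisjointABAPaths : (G : Graph) → Subset (n G) → Subset (n G) → ℕ → Set
HasDisjointABAPaths G A B k =
  Σ (Fin k → Path G) λ P →
    (∀ i → IsABAPath A B (P i)) × (∀ i j → i ≢ j → EdgeDisjoint (P i) (P j))

-- an edge set Z ⊆ E(G) with |Z| ≤ m meeting every A--B--A-path
-- (Z is a list of edges; its length bounds |Z|)
HasSmallHittingEdgeSet : (G : Graph) → Subset (n G) → Subset (n G) → ℕ → Set
HasSmallHittingEdgeSet G A B m =
  Σ (List (Vertex G × Vertex G)) λ Z →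
    All (λ { (u , v) → Adj G u v }) Z × length Z ≤ m ×
    (∀ (P : Path G) → IsABAPath A B P →
       ∃[ e ] ∃[ z ] (e ∈ₗ edgesOf P × z ∈ₗ Z × SameEdge e z))

module Submission where

-- Counterexample for k = 2.  Take a wall: an R × C grid whose vertex (r, c) keeps both horizontal
-- edges but only one vertical edge (down if r + c is even, up otherwise), with a terminal X joined to
-- the first column and a terminal Y joined to the last; A = {X, Y} and B is row 0.
--
-- Grid vertices have degree at most 3, so two edge-disjoint A-paths share no grid vertex.  Every
-- A–B–A path contains a walk from X to some (0, b′) and a walk from some (0, b) to Y.  If b < b′,
-- the parity of the number of edges of the first walk crossing the downward ray from a point is
-- constant along the second walk, which avoids the first, yet odd at (0, b) and even next to Y.
--
-- For a row r and an odd s there is an A–B–A path using only edges of row r, of the ascending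
-- staircase from (r, s − r) to (0, s) and of the descending staircase from (0, s + 1).  An edge lies
-- on at most two rows and four staircases, so m edges miss one of 2m + 1 rows and one of 4m + 1
-- staircases, and no m edges meet every A–B–A path.

open import Defs
open import Data.Nat using (ℕ; _≤_)
open import Data.Fin.Subset using (Subset)
open import Data.Product using (Σ)
open import Data.Sum using (_⊎_)
open import Relation.Nullary using (¬_)

open import Algebra.Bundles using (CommutativeRing)
open import Data.Bool using (Bool; true; false; not; _∧_; _xor_; if_then_else_)
import Data.Bool as Bool
open import Data.Bool.Properties using (xor-same; xor-assoc; xor-comm; xor-identityʳ; ∧-zeroʳ; not-involutive; T-≡; xor-∧-commutativeRing)
open import Data.Empty using (⊥; ⊥-elim)
open import Data.Fin as F using (Fin; toℕ; fromℕ<; remQuot; combine)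
open import Data.Fin.Properties using (toℕ-fromℕ<; fromℕ<-toℕ; remQuot-combine; combine-remQuot; toℕ<n)
import Data.Fin.Subset as Sub
open import Data.List using (List; []; _∷_; _++_; map; length; upTo; concatMap)
import Data.List.Properties as LP
open import Data.List.Membership.Propositional using (_∈_; _∉_; find)
open import Data.List.Membership.Propositional.Properties using (∈-++⁻; ∈-++⁺ˡ; ∈-++⁺ʳ; ∈-∃++; ∈-upTo⁻; ∈-map⁺; ∈-map⁻)
open import Data.List.Relation.Unary.All as All using (All; []; _∷_)
import Data.List.Relation.Unary.All.Properties as AllP
import Data.List.Relation.Unary.AllPairs as AllPairs
open import Data.List.Relation.Unary.Any as Any using (here; there)
open import Data.List.Relation.Unary.Linked as Linked using (Linked; []; [-]; _∷_)
import Data.List.Relation.Unary.Linked.Properties as LinkedP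
open import Data.List.Relation.Unary.Unique.Propositional using (Unique; []; _∷_)
import Data.List.Relation.Unary.Unique.Propositional.Properties as UP
open import Data.Nat as ℕ using (zero; suc; _+_; _*_; _∸_; _<_; _>_; z≤n; s≤s; _<?_; _≟_; _≡ᵇ_; _<ᵇ_)
import Data.Nat.Properties as ℕP
open import Data.Nat.Tactic.RingSolver using (solve-∀)
open import Data.List.Membership.DecPropositional _≟_ using (_∈?_)
import Data.Product as Product
open import Data.Product using (_×_; _,_; proj₁; proj₂; ∃-syntax; map₁)
open import Data.Sum using (inj₁; inj₂; swap)
open import Data.Unit using (⊤; tt)
open import Data.Vec using (tabulate)
open import Data.Vec.Properties using ([]=⇒lookup; lookup⇒[]=; lookup∘tabulate)
open import Function using (_∘_; id; flip)
open import Function.Bundles using (mk⇔; Equivalence)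
open import Function.Definitions using (Injective)
open import Relation.Binary.Construct.Closure.ReflexiveTransitive using (Star; ε; _◅_; _◅◅_)
open import Relation.Binary.Definitions using (Transitive; tri<; tri≈; tri>)
open import Relation.Binary.PropositionalEquality hiding (sym)
import Relation.Binary.PropositionalEquality as ≡
open import Relation.Nullary using (Dec; yes; no; does; ¬?; contradiction)
open import Relation.Nullary.Decidable using (map′; _×-dec_; _⊎-dec_; dec-true; dec-false; does-⇔; decidable-stable)
open import Algebra.Properties.CommutativeSemigroup (CommutativeRing.+-commutativeSemigroup xor-∧-commutativeRing)
  using () renaming (interchange to xor-interchange)

∈-++-∷⇒∈-++ : ∀ {A : Set} {x y : A} pre {post} → y ∈ pre ++ x ∷ post → y ≢ x → y ∈ pre ++ post
∈-++-∷⇒∈-++ pre y∈ y≢x with ∈-++⁻ pre y∈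
... | inj₁ y∈pre = ∈-++⁺ˡ y∈pre
... | inj₂ (here y≡x) = contradiction y≡x y≢x
... | inj₂ (there y∈post) = ∈-++⁺ʳ pre y∈post

length-++-∷ : ∀ {A : Set} (pre : List A) {x post} → length (pre ++ x ∷ post) ≡ suc (length (pre ++ post))
length-++-∷ pre {x} {post} = begin
  length (pre ++ x ∷ post)        ≡⟨ LP.length-++ pre ⟩
  length pre + suc (length post)  ≡⟨ ℕP.+-suc (length pre) (length post) ⟩
  suc (length pre + length post)  ≡⟨ cong suc (LP.length-++ pre) ⟨
  suc (length (pre ++ post))      ∎
  where open ≡-Reasoning

Unique⇒length≤ : ∀ {A : Set} {xs ys : List A} → Unique xs → All (_∈ ys) xs → length xs ≤ length ys
Unique⇒length≤ [] [] = z≤n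
Unique⇒length≤ (x≢xs ∷ u) (x∈ys ∷ xs⊆ys) with ∈-∃++ x∈ys
... | pre , post , refl = ℕP.≤-trans (s≤s (Unique⇒length≤ u xs⊆ys′)) (ℕP.≤-reflexive (≡.sym (length-++-∷ pre)))
  where
  xs⊆ys′ = All.zipWith (λ (y∈ , x≢y) → ∈-++-∷⇒∈-++ pre y∈ (x≢y ∘ ≡.sym)) (xs⊆ys , x≢xs)

∃-unlisted : ∀ (f : ℕ → ℕ) → Injective _≡_ _≡_ f → ∀ N (L : List ℕ) → length L ≤ N → ∃[ j ] j ≤ N × f j ∉ L
∃-unlisted f f-inj N L |L|≤N with Any.any? (λ j → ¬? (f j ∈? L)) (upTo (suc N))
... | yes some with find some
...   | j , j∈ , fj∉L = j , ℕP.≤-pred (∈-upTo⁻ j∈) , fj∉L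
∃-unlisted f f-inj N L |L|≤N | no none = ⊥-elim (ℕP.<-irrefl refl (ℕP.≤-trans allListed |L|≤N))
  where
  allListed : suc N ≤ length L
  allListed = subst (_≤ length L) (trans (LP.length-map f (upTo (suc N))) (LP.length-upTo (suc N)))
    (Unique⇒length≤ (UP.map⁺ f-inj (UP.upTo⁺ (suc N)))
      (AllP.map⁺ (All.map (decidable-stable (_ ∈? L)) (AllP.¬Any⇒All¬ _ none))))

Unique-++⁻ʳ : ∀ {A : Set} (xs : List A) {ys} → Unique (xs ++ ys) → Unique ys
Unique-++⁻ʳ [] u = u
Unique-++⁻ʳ (_ ∷ xs) (_ ∷ u) = Unique-++⁻ʳ xs u

Unique-++⇒disjoint : ∀ {A : Set} (xs : List A) {ys x} → Unique (xs ++ ys) → x ∈ xs → x ∉ ys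
Unique-++⇒disjoint (_ ∷ xs) (x≢ ∷ _) (here refl) x∈ys = All.lookup (AllP.++⁻ʳ xs x≢) x∈ys refl
Unique-++⇒disjoint (_ ∷ xs) (_ ∷ u) (there x∈xs) = Unique-++⇒disjoint xs u x∈xs

Linked⇒consecutive : ∀ {A : Set} {R : A → A → Set} {xs a b} → Linked R xs → (a , b) ∈ consecutive xs → R a b
Linked⇒consecutive (r ∷ _) (here refl) = r
Linked⇒consecutive (_ ∷ rs) (there p) = Linked⇒consecutive rs p

consecutive-map : ∀ {A B : Set} (f : A → B) (xs : List A) →
                  consecutive (map f xs) ≡ map (Product.map f f) (consecutive xs)
consecutive-map f [] = refl
consecutive-map f (x ∷ []) = refl
consecutive-map f (x ∷ y ∷ xs) = cong (_ ∷_) (consecutive-map f (y ∷ xs))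

∈-consecutive⇒∈ : ∀ {A : Set} {u v : A} xs → (u , v) ∈ consecutive xs → u ∈ xs × v ∈ xs
∈-consecutive⇒∈ (x ∷ y ∷ xs) (here refl) = here refl , there (here refl)
∈-consecutive⇒∈ (x ∷ y ∷ xs) (there p) with ∈-consecutive⇒∈ (y ∷ xs) p
... | u∈ , v∈ = there u∈ , there v∈

consecutive-++⁺ʳ : ∀ {A : Set} (pre : List A) {a rest e} → e ∈ consecutive (a ∷ rest) → e ∈ consecutive (pre ++ a ∷ rest)
consecutive-++⁺ʳ [] p = p
consecutive-++⁺ʳ (x ∷ []) p = there p
consecutive-++⁺ʳ (x ∷ y ∷ pre) p = there (consecutive-++⁺ʳ (y ∷ pre) p)

∈-interior : ∀ {A : Set} {s e x : A} xs → x ∈ s ∷ xs ++ e ∷ [] → x ≢ s → x ≢ e → x ∈ xs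
∈-interior xs (here refl) x≢s x≢e = contradiction refl x≢s
∈-interior xs (there x∈) x≢s x≢e with ∈-++⁻ xs x∈
... | inj₁ x∈xs = x∈xs
... | inj₂ (here refl) = contradiction refl x≢e

flanked : ∀ {A : Set} (a : A) xs b {v} → v ∈ xs → ∃[ pre ] ∃[ u ] ∃[ w ] ∃[ post ] a ∷ xs ++ b ∷ [] ≡ pre ++ u ∷ v ∷ w ∷ post
flanked a (x ∷ []) b (here refl) = [] , a , b , [] , refl
flanked a (x ∷ y ∷ xs) b (here refl) = [] , a , y , xs ++ b ∷ [] , refl
flanked a (x ∷ xs) b (there v∈) with flanked x xs b v∈
... | pre , u , w , post , eq = a ∷ pre , u , w , post , cong (a ∷_) eq

lastOr : ∀ {A : Set} → A → List A → A
lastOr x [] = x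
lastOr x (y ∷ ys) = lastOr y ys

lastOr-++ : ∀ {A : Set} (x : A) xs ys → lastOr x (xs ++ ys) ≡ lastOr (lastOr x xs) ys
lastOr-++ x [] ys = refl
lastOr-++ x (y ∷ xs) ys = lastOr-++ y xs ys

Linked-++⁺ : ∀ {A : Set} {R : A → A → Set} x xs {y} ys → Linked R (x ∷ xs) → lastOr x xs ≡ y → Linked R (y ∷ ys) → Linked R (x ∷ xs ++ ys)
Linked-++⁺ x [] ys _ refl rys = rys
Linked-++⁺ x (z ∷ xs) ys (r ∷ rxs) eq rys = r ∷ Linked-++⁺ z xs ys rxs eq rys

Linked-map-All : ∀ {A : Set} {R S : A → A → Set} {P : A → Set} → (∀ {u v} → R u v → P u → P v → S u v) →
                 ∀ {xs} → Linked R xs → All P xs → Linked S xs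
Linked-map-All f [] _ = []
Linked-map-All f [-] _ = [-]
Linked-map-All f (r ∷ rs) (pu ∷ pv ∷ ps) = f r pu pv ∷ Linked-map-All f rs (pv ∷ ps)

∈-concatMap⁺ : ∀ {A B : Set} (f : A → List B) {xs x y} → x ∈ xs → y ∈ f x → y ∈ concatMap f xs
∈-concatMap⁺ f (here refl) y∈ = ∈-++⁺ˡ y∈
∈-concatMap⁺ f {x ∷ _} (there x∈) y∈ = ∈-++⁺ʳ (f x) (∈-concatMap⁺ f x∈ y∈)

start≢end : ∀ {G} (P : Path G) → start P ≢ end P
start≢end P s≡e = UP.Unique[x∷xs]⇒x∉xs (unique P) (∈-++⁺ʳ (inner P) (here s≡e))

∈-tabulate⁻ : ∀ {m} (f : Fin m → Bool) {i} → i Sub.∈ tabulate f → f i ≡ true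
∈-tabulate⁻ f {i} i∈ = trans (≡.sym (lookup∘tabulate f i)) ([]=⇒lookup i∈)

∈-tabulate⁺ : ∀ {m} (f : Fin m → Bool) {i} → f i ≡ true → i Sub.∈ tabulate f
∈-tabulate⁺ f {i} fi = lookup⇒[]= i (tabulate f) (trans (lookup∘tabulate f i) fi)

dec-true⁻¹ : ∀ {A : Set} (a? : Dec A) → does a? ≡ true → A
dec-true⁻¹ (yes a) _ = a

≡ᵇ⇒≡′ : ∀ m n → (m ≡ᵇ n) ≡ true → m ≡ n
≡ᵇ⇒≡′ m n p = ℕP.≡ᵇ⇒≡ m n (Equivalence.from T-≡ p)

<⇒<ᵇ′ : ∀ {m n} → m < n → (m <ᵇ n) ≡ true
<⇒<ᵇ′ lt = Equivalence.to T-≡ (ℕP.<⇒<ᵇ lt)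

xor≡false⇒≡ : ∀ a b → a xor b ≡ false → a ≡ b
xor≡false⇒≡ false false _ = refl
xor≡false⇒≡ true true _ = refl

<ᵇ-sucʳ : ∀ m n → m ≢ n → (m <ᵇ suc n) ≡ (m <ᵇ n)
<ᵇ-sucʳ zero zero m≢n = contradiction refl m≢n
<ᵇ-sucʳ zero (suc n) _ = refl
<ᵇ-sucʳ (suc m) zero _ = refl
<ᵇ-sucʳ (suc m) (suc n) m≢n = <ᵇ-sucʳ m n (m≢n ∘ cong suc)

<ᵇ-sucˡ : ∀ m n → n ≢ suc m → (m <ᵇ n) ≡ (suc m <ᵇ n)
<ᵇ-sucˡ m zero _ = refl
<ᵇ-sucˡ zero (suc zero) n≢1 = contradiction refl n≢1
<ᵇ-sucˡ zero (suc (suc n)) _ = refl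
<ᵇ-sucˡ (suc m) (suc n) n≢m = <ᵇ-sucˡ m n (n≢m ∘ cong suc)

<ᵇ-xor-<ᵇ-sucʳ : ∀ m n → (m <ᵇ n) xor (m <ᵇ suc n) ≡ (n ≡ᵇ m)
<ᵇ-xor-<ᵇ-sucʳ zero zero = refl
<ᵇ-xor-<ᵇ-sucʳ zero (suc n) = refl
<ᵇ-xor-<ᵇ-sucʳ (suc m) zero = refl
<ᵇ-xor-<ᵇ-sucʳ (suc m) (suc n) = <ᵇ-xor-<ᵇ-sucʳ m n

double-injective : ∀ a b → a + a ≡ b + b → a ≡ b
double-injective zero zero _ = refl
double-injective (suc a) (suc b) eq rewrite ℕP.+-suc a a | ℕP.+-suc b b =
  cong suc (double-injective a b (ℕP.suc-injective (ℕP.suc-injective eq)))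

-- Walks

module _ {V : Set} {E : V → V → Set} where

  verticesOf : ∀ {u v} → Star E u v → List V
  verticesOf {u} ε = u ∷ []
  verticesOf {u} (_ ◅ w) = u ∷ verticesOf w

  source∈ : ∀ {u v} (w : Star E u v) → u ∈ verticesOf w
  source∈ ε = here refl
  source∈ (_ ◅ _) = here refl

  target∈ : ∀ {u v} (w : Star E u v) → v ∈ verticesOf w
  target∈ ε = here refl
  target∈ (_ ◅ w) = there (target∈ w)

  ∈-verticesOf-◅◅⁻ : ∀ {u v t x} (w : Star E u v) (w′ : Star E v t) → x ∈ verticesOf (w ◅◅ w′) → x ∈ verticesOf w ⊎ x ∈ verticesOf w′
  ∈-verticesOf-◅◅⁻ ε w′ x∈ = inj₂ x∈
  ∈-verticesOf-◅◅⁻ (_ ◅ w) w′ (here refl) = inj₁ (here refl)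
  ∈-verticesOf-◅◅⁻ (_ ◅ w) w′ (there x∈) with ∈-verticesOf-◅◅⁻ w w′ x∈
  ... | inj₁ x∈w = inj₁ (there x∈w)
  ... | inj₂ x∈w′ = inj₂ x∈w′

  reverse : (∀ {u v} → E u v → E v u) → ∀ {u v} → Star E u v → Star E v u
  reverse flip ε = ε
  reverse flip (e ◅ w) = reverse flip w ◅◅ (flip e ◅ ε)

  verticesOf-reverse : (flip : ∀ {u v} → E u v → E v u) {u v : V} (w : Star E u v) {x : V} → x ∈ verticesOf (reverse flip w) → x ∈ verticesOf w
  verticesOf-reverse flip ε x∈ = x∈
  verticesOf-reverse flip (e ◅ w) x∈ with ∈-verticesOf-◅◅⁻ (reverse flip w) (flip e ◅ ε) x∈
  ... | inj₁ x∈w = there (verticesOf-reverse flip w x∈w)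
  ... | inj₂ (here refl) = there (source∈ w)
  ... | inj₂ (there (here refl)) = here refl

  splitAt : ∀ {u v b} (w : Star E u v) → b ∈ verticesOf w →
            ∃[ pre ] Σ (Star E u b) λ w₁ → Σ (Star E b v) λ w₂ →
              verticesOf w₁ ≡ pre ++ b ∷ [] × verticesOf w ≡ pre ++ verticesOf w₂
  splitAt ε (here refl) = [] , ε , ε , refl , refl
  splitAt (e ◅ w) (here refl) = [] , ε , e ◅ w , refl , refl
  splitAt {u} (e ◅ w) (there b∈) with splitAt w b∈
  ... | pre , w₁ , w₂ , eq₁ , eq₂ = u ∷ pre , e ◅ w₁ , w₂ , cong (u ∷_) eq₁ , cong (u ∷_) eq₂

  parity : (∀ {u v} → E u v → Bool) → ∀ {a b} → Star E a b → Bool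
  parity F ε = false
  parity F (e ◅ w) = F e xor parity F w

  parity-xor : ∀ (F G : ∀ {u v} → E u v → Bool) {a b} (w : Star E a b) →
               parity (λ e → F e xor G e) w ≡ parity F w xor parity G w
  parity-xor F G ε = refl
  parity-xor F G (e ◅ w) = begin
    (F e xor G e) xor parity (λ e → F e xor G e) w  ≡⟨ cong ((F e xor G e) xor_) (parity-xor F G w) ⟩
    (F e xor G e) xor (parity F w xor parity G w)   ≡⟨ xor-interchange (F e) (G e) (parity F w) (parity G w) ⟩
    (F e xor parity F w) xor (G e xor parity G w)   ∎
    where open ≡-Reasoning

  parity-telescopes : (F : ∀ {u v} → E u v → Bool) (g : V → Bool) {P : V → Set} →
                      (∀ {u v} (e : E u v) → P u → P v → F e ≡ g u xor g v) →
                      ∀ {a b} (w : Star E a b) → All P (verticesOf w) → parity F w ≡ g a xor g b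
  parity-telescopes F g h {a} ε _ = ≡.sym (xor-same (g a))
  parity-telescopes F g h {a} {b} (_◅_ {j = v} e w) (pa ∷ ps) = begin
    F e xor parity F w               ≡⟨ cong₂ _xor_ (h e pa (All.lookup ps (source∈ w))) (parity-telescopes F g h w ps) ⟩
    (g a xor g v) xor (g v xor g b)  ≡⟨ xor-assoc (g a) (g v) (g v xor g b) ⟩
    g a xor (g v xor (g v xor g b))  ≡⟨ cong (g a xor_) (xor-assoc (g v) (g v) (g b)) ⟨
    g a xor ((g v xor g v) xor g b)  ≡⟨ cong (λ z → g a xor (z xor g b)) (xor-same (g v)) ⟩
    g a xor g b                      ∎
    where open ≡-Reasoning

  constant-along : ∀ {B : Set} (g : V → B) {P : V → Set} → (∀ {u v} → E u v → P u → P v → g u ≡ g v) →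
                   ∀ {a b} (w : Star E a b) → All P (verticesOf w) → g a ≡ g b
  constant-along g h ε _ = refl
  constant-along g h (e ◅ w) (pa ∷ ps) = trans (h e pa (All.lookup ps (source∈ w))) (constant-along g h w ps)

  splitAt-unique : ∀ {s t b} (w : Star E s t) → Unique (verticesOf w) → b ∈ verticesOf w → b ≢ s → b ≢ t →
                   Σ (Star E s b) λ w₁ → Σ (Star E b t) λ w₂ →
                     (∀ {x} → x ∈ verticesOf w₁ → x ∈ verticesOf w × x ≢ t) ×
                     (∀ {x} → x ∈ verticesOf w₂ → x ∈ verticesOf w × x ≢ s)
  splitAt-unique {s} {t} {b} w u b∈ b≢s b≢t with splitAt w b∈
  ... | pre , w₁ , w₂ , eq₁ , eq₂ = w₁ , w₂ , inFirst , inSecond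
    where
    u′ : Unique (pre ++ verticesOf w₂)
    u′ = subst Unique eq₂ u
    inW : ∀ {x} → x ∈ verticesOf w₂ → x ∈ verticesOf w
    inW x∈ = subst (_ ∈_) (≡.sym eq₂) (∈-++⁺ʳ pre x∈)
    inFirst : ∀ {x} → x ∈ verticesOf w₁ → x ∈ verticesOf w × x ≢ t
    inFirst x∈ with ∈-++⁻ pre (subst (_ ∈_) eq₁ x∈)
    ... | inj₁ x∈pre = subst (_ ∈_) (≡.sym eq₂) (∈-++⁺ˡ x∈pre) , λ { refl → Unique-++⇒disjoint pre u′ x∈pre (target∈ w₂) }
    ... | inj₂ (here refl) = b∈ , b≢t
    inSecond : ∀ {x} → x ∈ verticesOf w₂ → x ∈ verticesOf w × x ≢ s
    inSecond x∈ = inW x∈ , λ { refl → sourceNotInSecond (∈-++⁻ pre (subst (s ∈_) eq₁ (source∈ w₁))) x∈ }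
      where
      sourceNotInSecond : s ∈ pre ⊎ s ∈ b ∷ [] → s ∉ verticesOf w₂
      sourceNotInSecond (inj₁ s∈pre) = Unique-++⇒disjoint pre u′ s∈pre
      sourceNotInSecond (inj₂ (here refl)) _ = b≢s refl

-- The wall

-- pt r c is the grid vertex in row r and column c.
data Node : Set where
  X Y : Node
  pt  : ℕ → ℕ → Node

even : ℕ → Bool
even zero = true
even (suc n) = not (even n)

even-double : ∀ n → even (n + n) ≡ true
even-double zero = refl
even-double (suc n) rewrite ℕP.+-suc n n = trans (not-involutive (even (n + n))) (even-double n)

module Wall (R C : ℕ) where

  data Arc : Node → Node → Set where
    x-arc : ∀ r → Arc X (pt r 0)
    y-arc : ∀ r c → suc c ≡ C → Arc (pt r c) Y
    h-arc : ∀ r c → Arc (pt r c) (pt r (suc c))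
    v-arc : ∀ r c → even (r + c) ≡ true → Arc (pt r c) (pt (suc r) c)

  Edge : Node → Node → Set
  Edge u v = Arc u v ⊎ Arc v u

  arc? : ∀ u v → Dec (Arc u v)
  arc? X (pt r c) = map′ (λ { refl → x-arc r }) (λ { (x-arc _) → refl }) (c ≟ 0)
  arc? (pt r c) Y = map′ (y-arc r c) (λ { (y-arc _ _ p) → p }) (suc c ≟ C)
  arc? (pt r c) (pt r′ c′) =
    map′ toArc fromArc ((r ≟ r′ ×-dec suc c ≟ c′) ⊎-dec (suc r ≟ r′ ×-dec c ≟ c′ ×-dec even (r + c) Bool.≟ true))
    where
    toArc : (r ≡ r′ × suc c ≡ c′) ⊎ (suc r ≡ r′ × c ≡ c′ × even (r + c) ≡ true) → Arc (pt r c) (pt r′ c′)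
    toArc (inj₁ (refl , refl)) = h-arc r c
    toArc (inj₂ (refl , refl , p)) = v-arc r c p
    fromArc : Arc (pt r c) (pt r′ c′) → (r ≡ r′ × suc c ≡ c′) ⊎ (suc r ≡ r′ × c ≡ c′ × even (r + c) ≡ true)
    fromArc (h-arc _ _) = inj₁ (refl , refl)
    fromArc (v-arc _ _ p) = inj₂ (refl , refl , p)
  arc? X X = no λ ()
  arc? X Y = no λ ()
  arc? Y _ = no λ ()
  arc? (pt r c) X = no λ ()

  edge? : ∀ u v → Dec (Edge u v)
  edge? u v = arc? u v ⊎-dec arc? v u

  ¬loop : ∀ {v} → ¬ Edge v v
  ¬loop (inj₁ ())
  ¬loop (inj₂ ())

  InGrid : Node → Set
  InGrid (pt r c) = r < R × c < C
  InGrid _ = ⊤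

  size : ℕ
  size = 2 + R * C

  node : Fin size → Node
  node F.zero = X
  node (F.suc F.zero) = Y
  node (F.suc (F.suc i)) = pt (toℕ (proj₁ (remQuot {R} C i))) (toℕ (proj₂ (remQuot {R} C i)))

  index : Node → Fin size
  index X = F.zero
  index Y = F.suc F.zero
  index (pt r c) with r <? R | c <? C
  ... | yes r<R | yes c<C = F.suc (F.suc (combine (fromℕ< r<R) (fromℕ< c<C)))
  ... | _ | _ = F.zero

  node-index : ∀ v → InGrid v → node (index v) ≡ v
  node-index X _ = refl
  node-index Y _ = refl
  node-index (pt r c) (r<R , c<C) with r <? R | c <? C
  ... | yes r<R′ | yes c<C′ = cong₂ pt
        (trans (cong (toℕ ∘ proj₁) (remQuot-combine {R} {C} (fromℕ< r<R′) (fromℕ< c<C′))) (toℕ-fromℕ< r<R′))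
        (trans (cong (toℕ ∘ proj₂) (remQuot-combine {R} {C} (fromℕ< r<R′) (fromℕ< c<C′))) (toℕ-fromℕ< c<C′))
  ... | no r≮R | _ = contradiction r<R r≮R
  ... | yes _ | no c≮C = contradiction c<C c≮C

  node-inGrid : ∀ i → InGrid (node i)
  node-inGrid F.zero = tt
  node-inGrid (F.suc F.zero) = tt
  node-inGrid (F.suc (F.suc i)) = toℕ<n _ , toℕ<n _

  index-node : ∀ i → index (node i) ≡ i
  index-node F.zero = refl
  index-node (F.suc F.zero) = refl
  index-node (F.suc (F.suc i)) with toℕ (proj₁ (remQuot {R} C i)) <? R | toℕ (proj₂ (remQuot {R} C i)) <? C
  ... | yes p | yes q rewrite fromℕ<-toℕ (proj₁ (remQuot {R} C i)) p | fromℕ<-toℕ (proj₂ (remQuot {R} C i)) q =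
        cong (F.suc ∘ F.suc) (combine-remQuot {R} C i)
  ... | no ¬p | _ = contradiction (toℕ<n _) ¬p
  ... | yes _ | no ¬q = contradiction (toℕ<n _) ¬q

  node-injective : ∀ {i j} → node i ≡ node j → i ≡ j
  node-injective {i} {j} eq = trans (≡.sym (index-node i)) (trans (cong index eq) (index-node j))

  wall : Graph
  wall = record
    { n = size
    ; adj = λ i j → does (edge? (node i) (node j))
    ; sym = λ i j → does-⇔ (mk⇔ swap swap) (edge? (node i) (node j)) (edge? (node j) (node i))
    ; irrefl = λ i → dec-false (edge? (node i) (node i)) ¬loop
    }

  adj⇒edge : ∀ {i j} → Adj wall i j → Edge (node i) (node j)
  adj⇒edge {i} {j} = dec-true⁻¹ (edge? (node i) (node j))

  edge⇒adj : ∀ {u v} → Edge u v → InGrid u → InGrid v → Adj wall (index u) (index v)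
  edge⇒adj {u} {v} e gu gv = dec-true (edge? (node (index u)) (node (index v))) (subst₂ Edge (≡.sym (node-index u gu)) (≡.sym (node-index v gv)) e)

  leftOf : ℕ → ℕ → Node
  leftOf r zero = X
  leftOf r (suc c) = pt r c

  rightOf : ℕ → ℕ → Node
  rightOf r c = if does (suc c ≟ C) then Y else pt r (suc c)

  verticalOf : ℕ → ℕ → Node
  verticalOf r c = if even (r + c) then pt (suc r) c else pt (r ∸ 1) c

  neighbour∈ : ∀ r c {w} → Edge (pt r c) w → InGrid w → w ∈ leftOf r c ∷ rightOf r c ∷ verticalOf r c ∷ []
  neighbour∈ r c (inj₁ (y-arc _ _ last)) _ =
    there (here (cong (if_then Y else pt r (suc c)) (≡.sym (dec-true (suc c ≟ C) last))))
  neighbour∈ r c (inj₁ (h-arc _ _)) (_ , c+1<C) =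
    there (here (cong (if_then Y else pt r (suc c)) (≡.sym (dec-false (suc c ≟ C) (ℕP.<⇒≢ c+1<C)))))
  neighbour∈ r c (inj₁ (v-arc _ _ ev)) _ =
    there (there (here (cong (if_then pt (suc r) c else pt (r ∸ 1) c) (≡.sym ev))))
  neighbour∈ r c (inj₂ (x-arc _)) _ = here refl
  neighbour∈ r c (inj₂ (h-arc _ _)) _ = here refl
  neighbour∈ r c (inj₂ (v-arc r′ _ ev)) _ =
    there (there (here (cong (λ b → if not b then pt (suc r) c else pt r′ c) (≡.sym ev))))

  degree≤3 : ∀ {v ws} → v ≢ X → v ≢ Y → Unique ws → All (λ w → Edge v w × InGrid w) ws → length ws ≤ 3
  degree≤3 {X} v≢X _ = contradiction refl v≢X
  degree≤3 {Y} _ v≢Y = contradiction refl v≢Y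
  degree≤3 {pt r c} _ _ u nbrs = Unique⇒length≤ u (All.map (λ (e , g) → neighbour∈ r c e g) nbrs)

-- Crossing parity

module Crossing (R C : ℕ) where
  open Wall R C

  -- The horizontal edges between columns c and c + 1 strictly below row r: those crossed by the
  -- vertical ray going down from the point half-way between (r, c) and (r, c + 1).
  crossesRay : ℕ → ℕ → ∀ {u v} → Edge u v → Bool
  crossesRay r c (inj₁ (h-arc r₀ c₀)) = (r <ᵇ r₀) ∧ (c₀ ≡ᵇ c)
  crossesRay r c (inj₂ (h-arc r₀ c₀)) = (r <ᵇ r₀) ∧ (c₀ ≡ᵇ c)
  crossesRay r c _ = false

  module RayParity {b′} (W : Star Edge X (pt 0 b′)) where

    rayParity : Node → Bool
    rayParity (pt r c) = parity (crossesRay r c) W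
    rayParity _ = false

    -- In each *-step lemma the difference of two crossing counts on an edge is a coboundary
    -- g u xor g v, so that it telescopes along W.
    belowRight : ℕ → ℕ → Node → Bool
    belowRight r c (pt r′ c′) = (r <ᵇ r′) ∧ (c′ ≡ᵇ suc c)
    belowRight r c _ = false

    shiftʳ-step : ∀ r c {u v} (e : Edge u v) → u ≢ pt r (suc c) × u ≢ Y → v ≢ pt r (suc c) × v ≢ Y →
                  crossesRay r c e xor crossesRay r (suc c) e ≡ belowRight r c u xor belowRight r c v
    shiftʳ-step r c (inj₁ (x-arc r₀)) _ _ = ≡.sym (∧-zeroʳ (r <ᵇ r₀))
    shiftʳ-step r c (inj₁ (y-arc r₀ c₀ _)) _ (_ , v≢Y) = contradiction refl v≢Y
    shiftʳ-step r c (inj₁ (h-arc r₀ c₀)) _ _ = xor-comm ((r <ᵇ r₀) ∧ (c₀ ≡ᵇ c)) ((r <ᵇ r₀) ∧ (c₀ ≡ᵇ suc c))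
    shiftʳ-step r c (inj₁ (v-arc r₀ c₀ _)) (u≢ , _) _ with c₀ ≡ᵇ suc c in eq
    ... | false = ≡.sym (cong₂ _xor_ (∧-zeroʳ (r <ᵇ r₀)) (∧-zeroʳ (r <ᵇ suc r₀)))
    ... | true with ≡ᵇ⇒≡′ c₀ (suc c) eq
    ...   | refl rewrite <ᵇ-sucʳ r r₀ (λ r≡r₀ → u≢ (cong₂ pt (≡.sym r≡r₀) refl)) = ≡.sym (xor-same ((r <ᵇ r₀) ∧ true))
    shiftʳ-step r c (inj₂ (x-arc r₀)) _ _ = ≡.sym (trans (xor-identityʳ ((r <ᵇ r₀) ∧ false)) (∧-zeroʳ (r <ᵇ r₀)))
    shiftʳ-step r c (inj₂ (y-arc r₀ c₀ _)) (_ , u≢Y) _ = contradiction refl u≢Y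
    shiftʳ-step r c (inj₂ (h-arc r₀ c₀)) _ _ = refl
    shiftʳ-step r c (inj₂ (v-arc r₀ c₀ _)) _ (v≢ , _) with c₀ ≡ᵇ suc c in eq
    ... | false = ≡.sym (cong₂ _xor_ (∧-zeroʳ (r <ᵇ suc r₀)) (∧-zeroʳ (r <ᵇ r₀)))
    ... | true with ≡ᵇ⇒≡′ c₀ (suc c) eq
    ...   | refl rewrite <ᵇ-sucʳ r r₀ (λ r≡r₀ → v≢ (cong₂ pt (≡.sym r≡r₀) refl)) = ≡.sym (xor-same ((r <ᵇ r₀) ∧ true))

    rayParity-shiftʳ : ∀ r c → All (λ v → v ≢ pt r (suc c) × v ≢ Y) (verticesOf W) → rayParity (pt r c) ≡ rayParity (pt r (suc c))
    rayParity-shiftʳ r c avoids = xor≡false⇒≡ _ _ (trans (≡.sym (parity-xor (crossesRay r c) (crossesRay r (suc c)) W))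
      (parity-telescopes (λ e → crossesRay r c e xor crossesRay r (suc c) e) (belowRight r c) (shiftʳ-step r c) W avoids))

    shift↓-step : ∀ r c {u v} (e : Edge u v) → u ≢ pt (suc r) c → v ≢ pt (suc r) c →
                  crossesRay r c e xor crossesRay (suc r) c e ≡ false xor false
    shift↓-step r c (inj₁ (x-arc _)) _ _ = refl
    shift↓-step r c (inj₁ (y-arc _ _ _)) _ _ = refl
    shift↓-step r c (inj₁ (h-arc r₀ c₀)) u≢ _ with c₀ ≡ᵇ c in eq
    ... | false = cong₂ _xor_ (∧-zeroʳ (r <ᵇ r₀)) (∧-zeroʳ (suc r <ᵇ r₀))
    ... | true with ≡ᵇ⇒≡′ c₀ c eq
    ...   | refl rewrite <ᵇ-sucˡ r r₀ (λ r₀≡ → u≢ (cong₂ pt r₀≡ refl)) = xor-same ((suc r <ᵇ r₀) ∧ true)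
    shift↓-step r c (inj₁ (v-arc _ _ _)) _ _ = refl
    shift↓-step r c (inj₂ (x-arc _)) _ _ = refl
    shift↓-step r c (inj₂ (y-arc _ _ _)) _ _ = refl
    shift↓-step r c (inj₂ (h-arc r₀ c₀)) _ v≢ with c₀ ≡ᵇ c in eq
    ... | false = cong₂ _xor_ (∧-zeroʳ (r <ᵇ r₀)) (∧-zeroʳ (suc r <ᵇ r₀))
    ... | true with ≡ᵇ⇒≡′ c₀ c eq
    ...   | refl rewrite <ᵇ-sucˡ r r₀ (λ r₀≡ → v≢ (cong₂ pt r₀≡ refl)) = xor-same ((suc r <ᵇ r₀) ∧ true)
    shift↓-step r c (inj₂ (v-arc _ _ _)) _ _ = refl

    rayParity-shift↓ : ∀ r c → All (_≢ pt (suc r) c) (verticesOf W) → rayParity (pt r c) ≡ rayParity (pt (suc r) c)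
    rayParity-shift↓ r c avoids = xor≡false⇒≡ _ _ (trans (≡.sym (parity-xor (crossesRay r c) (crossesRay (suc r) c) W))
      (parity-telescopes (λ e → crossesRay r c e xor crossesRay (suc r) c e) (λ _ → false) (shift↓-step r c) W avoids))

    lastColumn-step : ∀ r c → suc c ≡ C → ∀ {u v} (e : Edge u v) → InGrid u → InGrid v → crossesRay r c e ≡ false xor false
    lastColumn-step r c last (inj₁ (h-arc r₀ c₀)) _ gv with c₀ ≡ᵇ c in eq
    ... | false = ∧-zeroʳ _
    ... | true with ≡ᵇ⇒≡′ c₀ c eq
    ...   | refl = contradiction (proj₂ gv) (ℕP.<-irrefl last)
    lastColumn-step r c last (inj₂ (h-arc r₀ c₀)) gu _ with c₀ ≡ᵇ c in eq
    ... | false = ∧-zeroʳ _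
    ... | true with ≡ᵇ⇒≡′ c₀ c eq
    ...   | refl = contradiction (proj₂ gu) (ℕP.<-irrefl last)
    lastColumn-step r c last (inj₁ (x-arc _)) _ _ = refl
    lastColumn-step r c last (inj₁ (y-arc _ _ _)) _ _ = refl
    lastColumn-step r c last (inj₁ (v-arc _ _ _)) _ _ = refl
    lastColumn-step r c last (inj₂ (x-arc _)) _ _ = refl
    lastColumn-step r c last (inj₂ (y-arc _ _ _)) _ _ = refl
    lastColumn-step r c last (inj₂ (v-arc _ _ _)) _ _ = refl

    rayParity-lastColumn : ∀ r c → suc c ≡ C → All InGrid (verticesOf W) → rayParity (pt r c) ≡ false
    rayParity-lastColumn r c last inGrid = parity-telescopes (crossesRay r c) (λ _ → false) (lastColumn-step r c last) W inGrid

    rightOfColumn : ℕ → Node → Bool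
    rightOfColumn b (pt _ c) = b <ᵇ c
    rightOfColumn b Y = true
    rightOfColumn b X = false

    belowRow0 : ∀ {b} r₀ c₀ → pt r₀ c₀ ≢ pt 0 b → (0 <ᵇ r₀) ∧ (c₀ ≡ᵇ b) ≡ (c₀ ≡ᵇ b)
    belowRow0 (suc r₀) c₀ _ = refl
    belowRow0 {b} zero c₀ ≢b with c₀ ≡ᵇ b in eq
    ... | false = refl
    ... | true = contradiction (cong (pt 0) (≡ᵇ⇒≡′ c₀ b eq)) ≢b

    row0-step : ∀ b {u v} (e : Edge u v) → u ≢ pt 0 b × u ≢ Y → v ≢ pt 0 b × v ≢ Y →
                crossesRay 0 b e ≡ rightOfColumn b u xor rightOfColumn b v
    row0-step b (inj₁ (x-arc _)) _ _ = refl
    row0-step b (inj₁ (y-arc _ _ _)) _ (_ , v≢Y) = contradiction refl v≢Y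
    row0-step b (inj₁ (h-arc r₀ c₀)) (u≢ , _) _ rewrite <ᵇ-xor-<ᵇ-sucʳ b c₀ = belowRow0 r₀ c₀ u≢
    row0-step b (inj₁ (v-arc _ c₀ _)) _ _ = ≡.sym (xor-same (b <ᵇ c₀))
    row0-step b (inj₂ (x-arc _)) _ _ = refl
    row0-step b (inj₂ (y-arc _ _ _)) (_ , u≢Y) _ = contradiction refl u≢Y
    row0-step b (inj₂ (h-arc r₀ c₀)) _ (v≢ , _) rewrite xor-comm (b <ᵇ suc c₀) (b <ᵇ c₀) | <ᵇ-xor-<ᵇ-sucʳ b c₀ = belowRow0 r₀ c₀ v≢
    row0-step b (inj₂ (v-arc _ c₀ _)) _ _ = ≡.sym (xor-same (b <ᵇ c₀))

    rayParity-row0 : ∀ b → b < b′ → All (λ v → v ≢ pt 0 b × v ≢ Y) (verticesOf W) → rayParity (pt 0 b) ≡ true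
    rayParity-row0 b b<b′ avoids = trans (parity-telescopes (crossesRay 0 b) (rightOfColumn b) (row0-step b) W avoids) (<⇒<ᵇ′ b<b′)


  noCrossing : ∀ {b b′} (W₁ : Star Edge X (pt 0 b′)) (W₂ : Star Edge (pt 0 b) Y) → b < b′ →
               All InGrid (verticesOf W₁) → (∀ {v} → v ∈ verticesOf W₁ → v ∉ verticesOf W₂) → ⊥
  noCrossing W₁ W₂ b<b′ inGrid disjoint =
    contradiction (trans (≡.sym (rayParity-row0 _ b<b′ (avoids₂ (source∈ W₂) (target∈ W₂))))
                         (constant-along rayParity step W₂ (All.tabulate id)))
                  λ ()
    where
    open RayParity W₁
    avoids : ∀ {z} → z ∈ verticesOf W₂ → All (_≢ z) (verticesOf W₁)
    avoids z∈ = All.tabulate λ v∈ v≡z → disjoint v∈ (subst (_∈ _) (≡.sym v≡z) z∈)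
    avoids₂ : ∀ {z z′} → z ∈ verticesOf W₂ → z′ ∈ verticesOf W₂ → All (λ v → v ≢ z × v ≢ z′) (verticesOf W₁)
    avoids₂ z∈ z′∈ = All.zip (avoids z∈ , avoids z′∈)
    step : ∀ {u v} → Edge u v → u ∈ verticesOf W₂ → v ∈ verticesOf W₂ → rayParity u ≡ rayParity v
    step (inj₁ (x-arc _)) X∈ _ = contradiction X∈ (disjoint (source∈ W₁))
    step (inj₂ (x-arc _)) _ X∈ = contradiction X∈ (disjoint (source∈ W₁))
    step (inj₁ (y-arc r c last)) _ _ = rayParity-lastColumn r c last inGrid
    step (inj₂ (y-arc r c last)) _ _ = ≡.sym (rayParity-lastColumn r c last inGrid)
    step (inj₁ (h-arc r c)) _ v∈ = rayParity-shiftʳ r c (avoids₂ v∈ (target∈ W₂))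
    step (inj₂ (h-arc r c)) u∈ _ = ≡.sym (rayParity-shiftʳ r c (avoids₂ u∈ (target∈ W₂)))
    step (inj₁ (v-arc r c _)) _ v∈ = rayParity-shift↓ r c (avoids v∈)
    step (inj₂ (v-arc r c _)) u∈ _ = ≡.sym (rayParity-shift↓ r c (avoids u∈))

-- Edge-disjoint A–B–A paths

module TwoPaths (R C : ℕ) where
  open Wall R C
  open Crossing R C

  isTerminal : Node → Bool
  isTerminal X = true
  isTerminal Y = true
  isTerminal (pt _ _) = false

  inRow0 : Node → Bool
  inRow0 (pt zero _) = true
  inRow0 _ = false

  A B : Subset size
  A = tabulate (isTerminal ∘ node)
  B = tabulate (inRow0 ∘ node)

  terminal⇒X⊎Y : ∀ {i} → i Sub.∈ A → node i ≡ X ⊎ node i ≡ Y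
  terminal⇒X⊎Y {i} i∈A with node i | ∈-tabulate⁻ (isTerminal ∘ node) i∈A
  ... | X | _ = inj₁ refl
  ... | Y | _ = inj₂ refl

  row0⇒pt : ∀ {i} → i Sub.∈ B → ∃[ c ] node i ≡ pt 0 c
  row0⇒pt {i} i∈B with node i | ∈-tabulate⁻ (inRow0 ∘ node) i∈B
  ... | pt zero c | _ = c , refl

  nodesOf : Path wall → List Node
  nodesOf P = map node (vertices P)

  innerNeighbours : ∀ (P : Path wall) {i} → i ∈ inner P →
                    ∃[ u ] ∃[ w ] (u , i) ∈ edgesOf P × (i , w) ∈ edgesOf P × u ≢ w
  innerNeighbours P {i} i∈ with flanked (start P) (inner P) (end P) i∈
  ... | pre , u , w , post , eq =
    u , w , edgeIn (consecutive-++⁺ʳ pre (here refl)) , edgeIn (consecutive-++⁺ʳ pre (there (here refl))) , u≢w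
    where
    edgeIn : ∀ {e} → e ∈ consecutive (pre ++ u ∷ i ∷ w ∷ post) → e ∈ edgesOf P
    edgeIn = subst (λ xs → _ ∈ consecutive xs) (≡.sym eq)
    u≢w : u ≢ w
    u≢w with Unique-++⁻ʳ pre (subst Unique eq (unique P))
    ... | u≢ ∷ _ = All.lookup u≢ (there (here refl))

  grid⇒inner : ∀ {P : Path wall} → IsAPath A P → ∀ {i} → i ∈ vertices P → node i ≢ X → node i ≢ Y → i ∈ inner P
  grid⇒inner {P} (s∈A , e∈A , _) {i} i∈ ≢X ≢Y = ∈-interior (inner P) i∈ (notTerminal s∈A) (notTerminal e∈A)
    where
    notTerminal : ∀ {j} → j Sub.∈ A → i ≢ j
    notTerminal j∈A refl with terminal⇒X⊎Y j∈A
    ... | inj₁ isX = ≢X isX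
    ... | inj₂ isY = ≢Y isY

  GridDisjoint : Path wall → Path wall → Set
  GridDisjoint P Q = ∀ {v} → v ∈ nodesOf P → v ∈ nodesOf Q → v ≢ X → v ≢ Y → ⊥

  edgeDisjoint⇒gridDisjoint : ∀ {P Q : Path wall} → IsAPath A P → IsAPath A Q → EdgeDisjoint P Q → GridDisjoint P Q
  edgeDisjoint⇒gridDisjoint {P} {Q} aP aQ disjoint v∈P v∈Q ≢X ≢Y with ∈-map⁻ node v∈P | ∈-map⁻ node v∈Q
  ... | i , i∈P , refl | j , j∈Q , i≡j with node-injective i≡j
  ... | refl with innerNeighbours P (grid⇒inner {P} aP i∈P ≢X ≢Y) | innerNeighbours Q (grid⇒inner {Q} aQ j∈Q ≢X ≢Y)
  ... | u₁ , w₁ , u₁i , iw₁ , u₁≢w₁ | u₂ , w₂ , u₂i , iw₂ , u₂≢w₂ = ℕP.<-irrefl refl (degree≤3 ≢X ≢Y distinct neighbours)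
    where
    nodes≢ : ∀ {a b} → a ≢ b → node a ≢ node b
    nodes≢ a≢b = a≢b ∘ node-injective
    distinct : Unique (node u₁ ∷ node w₁ ∷ node u₂ ∷ node w₂ ∷ [])
    distinct = (nodes≢ u₁≢w₁ ∷ nodes≢ (λ { refl → disjoint _ _ u₁i u₂i (inj₁ (refl , refl)) })
                             ∷ nodes≢ (λ { refl → disjoint _ _ u₁i iw₂ (inj₂ (refl , refl)) }) ∷ [])
             ∷ (nodes≢ (λ { refl → disjoint _ _ iw₁ u₂i (inj₂ (refl , refl)) })
                ∷ nodes≢ (λ { refl → disjoint _ _ iw₁ iw₂ (inj₁ (refl , refl)) }) ∷ [])
             ∷ (nodes≢ u₂≢w₂ ∷ []) ∷ [] ∷ []
    neighbours : All (λ w → Edge (node i) w × InGrid w) (node u₁ ∷ node w₁ ∷ node u₂ ∷ node w₂ ∷ [])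
    neighbours = (swap (adj⇒edge (Linked⇒consecutive (linked P) u₁i)) , node-inGrid u₁)
               ∷ (adj⇒edge (Linked⇒consecutive (linked P) iw₁) , node-inGrid w₁)
               ∷ (swap (adj⇒edge (Linked⇒consecutive (linked Q) u₂i)) , node-inGrid u₂)
               ∷ (adj⇒edge (Linked⇒consecutive (linked Q) iw₂) , node-inGrid w₂) ∷ []

  linkedWalk : ∀ s xs e → Linked (Adj wall) (s ∷ xs ++ e ∷ []) →
               Σ (Star Edge (node s) (node e)) λ w → verticesOf w ≡ map node (s ∷ xs ++ e ∷ [])
  linkedWalk s [] e (a ∷ [-]) = adj⇒edge a ◅ ε , refl
  linkedWalk s (x ∷ xs) e (a ∷ lk) with linkedWalk x xs e lk
  ... | w , eq = adj⇒edge a ◅ w , cong (node s ∷_) eq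

  terminalEnds : ∀ (P : Path wall) → IsAPath A P → (node (start P) ≡ X × node (end P) ≡ Y) ⊎ (node (start P) ≡ Y × node (end P) ≡ X)
  terminalEnds P (s∈A , e∈A , _) with terminal⇒X⊎Y s∈A | terminal⇒X⊎Y e∈A
  ... | inj₁ sX | inj₂ eY = inj₁ (sX , eY)
  ... | inj₂ sY | inj₁ eX = inj₂ (sY , eX)
  ... | inj₁ sX | inj₁ eX = contradiction (node-injective (trans sX (≡.sym eX))) (start≢end P)
  ... | inj₂ sY | inj₂ eY = contradiction (node-injective (trans sY (≡.sym eY))) (start≢end P)

  record ThroughRow0 (P : Path wall) : Set where
    field
      column    : ℕ
      toRow0    : Star Edge X (pt 0 column)
      fromRow0  : Star Edge (pt 0 column) Y
      toRow0⊆   : ∀ {x} → x ∈ verticesOf toRow0 → x ∈ nodesOf P × x ≢ Y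
      fromRow0⊆ : ∀ {x} → x ∈ verticesOf fromRow0 → x ∈ nodesOf P × x ≢ X

  throughRow0 : ∀ P {s t} (w : Star Edge s t) → Unique (verticesOf w) → (∀ {x} → x ∈ verticesOf w → x ∈ nodesOf P) →
                (s ≡ X × t ≡ Y) ⊎ (s ≡ Y × t ≡ X) → ∀ {b} → pt 0 b ∈ verticesOf w → ThroughRow0 P
  throughRow0 P w u w⊆P (inj₁ (refl , refl)) b∈ with splitAt-unique w u b∈ (λ ()) (λ ())
  ... | w₁ , w₂ , w₁⊆ , w₂⊆ = record
    { toRow0 = w₁ ; fromRow0 = w₂ ; toRow0⊆ = map₁ w⊆P ∘ w₁⊆ ; fromRow0⊆ = map₁ w⊆P ∘ w₂⊆ }
  throughRow0 P w u w⊆P (inj₂ (refl , refl)) b∈ with splitAt-unique w u b∈ (λ ()) (λ ())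
  ... | w₁ , w₂ , w₁⊆ , w₂⊆ = record
    { toRow0 = reverse swap w₂ ; fromRow0 = reverse swap w₁
    ; toRow0⊆ = map₁ w⊆P ∘ w₂⊆ ∘ verticesOf-reverse swap w₂
    ; fromRow0⊆ = map₁ w⊆P ∘ w₁⊆ ∘ verticesOf-reverse swap w₁ }

  abaThroughRow0 : ∀ P → IsABAPath A B P → ThroughRow0 P
  abaThroughRow0 P (aP , someB) with linkedWalk (start P) (inner P) (end P) (linked P) | find someB
  ... | w , w≡P | i , i∈P , i∈B with row0⇒pt i∈B
  ... | b , i≡b = throughRow0 P w unique-w w⊆P (terminalEnds P aP) b∈w
    where
    unique-w : Unique (verticesOf w)
    unique-w = subst Unique (≡.sym w≡P) (UP.map⁺ node-injective (unique P))
    w⊆P : ∀ {x} → x ∈ verticesOf w → x ∈ nodesOf P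
    w⊆P = subst (_ ∈_) w≡P
    b∈w : pt 0 b ∈ verticesOf w
    b∈w = subst (_∈ verticesOf w) i≡b (subst (node i ∈_) (≡.sym w≡P) (∈-map⁺ node i∈P))

  nodesOf-inGrid : ∀ {P x} → x ∈ nodesOf P → InGrid x
  nodesOf-inGrid x∈ with ∈-map⁻ node x∈
  ... | i , _ , refl = node-inGrid i

  open ThroughRow0

  toRow0-inGrid : ∀ {P} (T : ThroughRow0 P) → All InGrid (verticesOf (toRow0 T))
  toRow0-inGrid {P} T = All.tabulate (nodesOf-inGrid {P} ∘ proj₁ ∘ toRow0⊆ T)

  ¬gridDisjoint : ∀ {P Q} → ThroughRow0 P → ThroughRow0 Q → ¬ GridDisjoint P Q
  ¬gridDisjoint TP TQ disjoint with ℕP.<-cmp (column TP) (column TQ)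
  ... | tri< lt _ _ = noCrossing (toRow0 TQ) (fromRow0 TP) lt (toRow0-inGrid TQ) λ v∈Q v∈P →
        disjoint (proj₁ (fromRow0⊆ TP v∈P)) (proj₁ (toRow0⊆ TQ v∈Q)) (proj₂ (fromRow0⊆ TP v∈P)) (proj₂ (toRow0⊆ TQ v∈Q))
  ... | tri> _ _ gt = noCrossing (toRow0 TP) (fromRow0 TQ) gt (toRow0-inGrid TP) λ v∈P v∈Q →
        disjoint (proj₁ (toRow0⊆ TP v∈P)) (proj₁ (fromRow0⊆ TQ v∈Q)) (proj₂ (fromRow0⊆ TQ v∈Q)) (proj₂ (toRow0⊆ TP v∈P))
  ... | tri≈ _ same _ = disjoint (proj₁ (fromRow0⊆ TP (source∈ (fromRow0 TP))))
        (proj₁ (fromRow0⊆ TQ (subst (λ b → pt 0 b ∈ _) (≡.sym same) (source∈ (fromRow0 TQ))))) (λ ()) (λ ())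

  noTwoEdgeDisjointABAPaths : ∀ {P Q : Path wall} → IsABAPath A B P → IsABAPath A B Q → ¬ EdgeDisjoint P Q
  noTwoEdgeDisjointABAPaths {P} {Q} abaP abaQ disjoint =
    ¬gridDisjoint (abaThroughRow0 P abaP) (abaThroughRow0 Q abaQ) (edgeDisjoint⇒gridDisjoint {P} {Q} (proj₁ abaP) (proj₁ abaQ) disjoint)

  ¬twoDisjointABAPaths : ¬ HasDisjointABAPaths wall A B 2
  ¬twoDisjointABAPaths (P , aba , disjoint) =
    noTwoEdgeDisjointABAPaths {P F.zero} {P (F.suc F.zero)} (aba F.zero) (aba (F.suc F.zero)) (disjoint F.zero (F.suc F.zero) λ ())

-- Routes

rowLabel : Node → Node → ℕ
rowLabel (pt a _) _ = a
rowLabel X (pt a _) = a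
rowLabel _ _ = 0

ascentLabel : Node → Node → ℕ
ascentLabel (pt a _) (pt _ b′) = a + b′
ascentLabel _ _ = 0

descentLabel : Node → Node → ℕ
descentLabel (pt _ b) (pt a′ _) = b ∸ a′
descentLabel _ _ = 0

-- Every edge of the route through row r and staircase s (module Route) is labelled r or s.
Labelled : ℕ → ℕ → Node → Node → Set
Labelled r s u v = rowLabel u v ≡ r ⊎ ascentLabel u v ≡ s ⊎ descentLabel u v ≡ s

columnOf : Node → ℕ
columnOf (pt _ b) = b
columnOf _ = 0

rowOf : Node → ℕ
rowOf (pt a _) = a
rowOf _ = 0

ColumnThen : (ℕ → ℕ → Set) → Node → Node → Set
ColumnThen _≺_ u v = columnOf u < columnOf v ⊎ (columnOf u ≡ columnOf v × rowOf u ≺ rowOf v)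

ColumnThen-trans : ∀ {_≺_ : ℕ → ℕ → Set} → Transitive _≺_ → ∀ {u v w} → ColumnThen _≺_ u v → ColumnThen _≺_ v w → ColumnThen _≺_ u w
ColumnThen-trans ≺-trans (inj₁ p) (inj₁ q) = inj₁ (ℕP.<-trans p q)
ColumnThen-trans ≺-trans (inj₁ p) (inj₂ (e , _)) = inj₁ (subst (_ <_) e p)
ColumnThen-trans ≺-trans (inj₂ (e , _)) (inj₁ q) = inj₁ (subst (_< _) (≡.sym e) q)
ColumnThen-trans ≺-trans (inj₂ (e , p)) (inj₂ (e′ , q)) = inj₂ (trans e e′ , ≺-trans p q)

ColumnThen-irrefl : ∀ {_≺_ : ℕ → ℕ → Set} → (∀ {n} → ¬ n ≺ n) → ∀ {u v} → ColumnThen _≺_ u v → u ≢ v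
ColumnThen-irrefl ≺-irrefl (inj₁ p) refl = ℕP.<-irrefl refl p
ColumnThen-irrefl ≺-irrefl (inj₂ (_ , p)) refl = ≺-irrefl p

Linked⇒Unique : ∀ {_≺_ : ℕ → ℕ → Set} → Transitive _≺_ → (∀ {n} → ¬ n ≺ n) → ∀ {xs} → Linked (ColumnThen _≺_) xs → Unique xs
Linked⇒Unique {_≺_} ≺-trans ≺-irrefl lk =
  AllPairs.map (λ {u} {v} → ColumnThen-irrefl {_≺_} ≺-irrefl {u} {v})
    (LinkedP.Linked⇒AllPairs (λ {u} {v} {w} → ColumnThen-trans {_≺_} ≺-trans {u} {v} {w}) lk)

rowSegment : ℕ → ℕ → ℕ → List Node
rowSegment r a zero = []
rowSegment r a (suc k) = pt r (suc a) ∷ rowSegment r (suc a) k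

ascent : ℕ → ℕ → List Node
ascent zero b = []
ascent (suc h) b = pt h b ∷ pt h (suc b) ∷ ascent h (suc b)

descent : ℕ → ℕ → ℕ → List Node
descent zero a b = []
descent (suc h) a b = pt (suc a) b ∷ pt (suc a) (suc b) ∷ descent h (suc a) (suc b)

lastOr-rowSegment : ∀ r a k → lastOr (pt r a) (rowSegment r a k) ≡ pt r (k + a)
lastOr-rowSegment r a zero = refl
lastOr-rowSegment r a (suc k) = trans (lastOr-rowSegment r (suc a) k) (cong (pt r) (ℕP.+-suc k a))

lastOr-ascent : ∀ h b → lastOr (pt h b) (ascent h b) ≡ pt 0 (h + b)
lastOr-ascent zero b = refl
lastOr-ascent (suc h) b = trans (lastOr-ascent h (suc b)) (cong (pt 0) (ℕP.+-suc h b))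

lastOr-descent : ∀ h a b → lastOr (pt a b) (descent h a b) ≡ pt (h + a) (h + b)
lastOr-descent zero a b = refl
lastOr-descent (suc h) a b = trans (lastOr-descent h (suc a) (suc b)) (cong₂ pt (ℕP.+-suc h a) (ℕP.+-suc h b))

InBox : ℕ → ℕ → ℕ → Node → Set
InBox rmax lo hi (pt a b) = a ≤ rmax × lo ≤ b × b ≤ hi
InBox _ _ _ _ = ⊥

rowSegment-inBox : ∀ r a k {rmax lo hi} → r ≤ rmax → lo ≤ suc a → k + a ≤ hi → All (InBox rmax lo hi) (rowSegment r a k)
rowSegment-inBox r a zero _ _ _ = []
rowSegment-inBox r a (suc k) r≤ lo≤ ≤hi =
  (r≤ , lo≤ , ℕP.≤-trans (s≤s (ℕP.m≤n+m a k)) ≤hi)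
  ∷ rowSegment-inBox r (suc a) k r≤ (ℕP.m≤n⇒m≤1+n lo≤) (ℕP.≤-trans (ℕP.≤-reflexive (ℕP.+-suc k a)) ≤hi)

ascent-inBox : ∀ h b {rmax lo hi} → h ≤ rmax → lo ≤ b → h + b ≤ hi → All (InBox rmax lo hi) (ascent h b)
ascent-inBox zero b _ _ _ = []
ascent-inBox (suc h) b h≤ lo≤ ≤hi =
  (h≤′ , lo≤ , ℕP.≤-trans (ℕP.m≤n+m b (suc h)) ≤hi)
  ∷ (h≤′ , ℕP.m≤n⇒m≤1+n lo≤ , ℕP.≤-trans (s≤s (ℕP.m≤n+m b h)) ≤hi)
  ∷ ascent-inBox h (suc b) h≤′ (ℕP.m≤n⇒m≤1+n lo≤) (ℕP.≤-trans (ℕP.≤-reflexive (ℕP.+-suc h b)) ≤hi)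
  where h≤′ = ℕP.≤-trans (ℕP.n≤1+n h) h≤

descent-inBox : ∀ h a b {rmax lo hi} → h + a ≤ rmax → lo ≤ b → h + b ≤ hi → All (InBox rmax lo hi) (descent h a b)
descent-inBox zero a b _ _ _ = []
descent-inBox (suc h) a b ≤rmax lo≤ ≤hi =
  (a+1≤ , lo≤ , ℕP.≤-trans (ℕP.m≤n+m b (suc h)) ≤hi)
  ∷ (a+1≤ , ℕP.m≤n⇒m≤1+n lo≤ , ℕP.≤-trans (s≤s (ℕP.m≤n+m b h)) ≤hi)
  ∷ descent-inBox h (suc a) (suc b) (ℕP.≤-trans (ℕP.≤-reflexive (ℕP.+-suc h a)) ≤rmax) (ℕP.m≤n⇒m≤1+n lo≤)
      (ℕP.≤-trans (ℕP.≤-reflexive (ℕP.+-suc h b)) ≤hi)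
  where a+1≤ = ℕP.≤-trans (s≤s (ℕP.m≤n+m a h)) ≤rmax

inBox⇒grid : ∀ {rmax lo hi v} → InBox rmax lo hi v → v ≢ X × v ≢ Y
inBox⇒grid {v = pt _ _} _ = (λ ()) , (λ ())

module Route (R C r q turn tail : ℕ) (turn+r : turn + r ≡ suc (q + q)) (r<R : r < R)
             (width : suc (tail + (r + suc (suc (q + q)))) ≡ C) where
  open Wall R C

  s : ℕ
  s = suc (q + q)

  Step : Node → Node → Set
  Step u v = Edge u v × Labelled r s u v

  rowSegment-linked : ∀ a k → Linked (λ u v → Step u v × columnOf u < columnOf v) (pt r a ∷ rowSegment r a k)
  rowSegment-linked a zero = [-]
  rowSegment-linked a (suc k) = ((inj₁ (h-arc r a) , inj₁ refl) , ℕP.≤-refl) ∷ rowSegment-linked (suc a) k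

  ascent-linked : ∀ h b → h + b ≡ s → Linked (λ u v → Step u v × ColumnThen _>_ u v) (pt h b ∷ ascent h b)
  ascent-linked zero b _ = [-]
  ascent-linked (suc h) b h+b≡s =
    ((inj₂ (v-arc h b evenHB) , inj₂ (inj₁ h+b≡s)) , inj₂ (refl , ℕP.≤-refl))
    ∷ ((inj₁ (h-arc h b) , inj₂ (inj₁ h+b+1≡s)) , inj₁ ℕP.≤-refl)
    ∷ ascent-linked h (suc b) h+b+1≡s
    where
    h+b+1≡s : h + suc b ≡ s
    h+b+1≡s = trans (ℕP.+-suc h b) h+b≡s
    evenHB : even (h + b) ≡ true
    evenHB = subst (λ n → even n ≡ true) (≡.sym (ℕP.suc-injective h+b≡s)) (even-double q)

  descent-linked : ∀ h a b → b ≡ suc a + s → Linked (λ u v → Step u v × ColumnThen _<_ u v) (pt a b ∷ descent h a b)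
  descent-linked zero a b _ = [-]
  descent-linked (suc h) a .(suc a + s) refl =
    ((inj₁ (v-arc a (suc a + s) evenAB) , inj₂ (inj₂ (ℕP.m+n∸m≡n (suc a) s))) , inj₂ (refl , ℕP.≤-refl))
    ∷ ((inj₁ (h-arc (suc a) (suc a + s)) , inj₂ (inj₂ (ℕP.m+n∸m≡n (suc a) s))) , inj₁ ℕP.≤-refl)
    ∷ descent-linked h (suc a) (suc (suc a + s)) refl
    where
    twice : ∀ a q → a + (suc a + suc (q + q)) ≡ suc (suc ((a + q) + (a + q)))
    twice = solve-∀
    evenAB : even (a + (suc a + s)) ≡ true
    evenAB = trans (cong even (twice a q)) (trans (not-involutive _) (even-double (a + q)))

  leftPart rightPart middle route : List Node
  leftPart = rowSegment r 0 turn ++ ascent r turn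
  rightPart = descent r 0 (suc s) ++ rowSegment r (r + suc s) tail
  middle = (pt r 0 ∷ leftPart) ++ (pt 0 (suc s) ∷ rightPart)
  route = X ∷ middle ++ Y ∷ []

  lastColumn : ℕ
  lastColumn = tail + (r + suc s)

  r+turn≡s : r + turn ≡ s
  r+turn≡s = trans (ℕP.+-comm r turn) turn+r

  lastOr-turn : lastOr (pt r 0) (rowSegment r 0 turn) ≡ pt r turn
  lastOr-turn = trans (lastOr-rowSegment r 0 turn) (cong (pt r) (ℕP.+-identityʳ turn))

  leftPart-linked : Linked (λ u v → Step u v × ColumnThen _>_ u v) (pt r 0 ∷ leftPart)
  leftPart-linked = Linked-++⁺ (pt r 0) (rowSegment r 0 turn) (ascent r turn)
    (Linked.map (λ (st , lt) → st , inj₁ lt) (rowSegment-linked 0 turn)) lastOr-turn (ascent-linked r turn r+turn≡s)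

  lastOr-leftPart : lastOr (pt r 0) leftPart ≡ pt 0 s
  lastOr-leftPart = begin
    lastOr (pt r 0) leftPart                               ≡⟨ lastOr-++ (pt r 0) (rowSegment r 0 turn) (ascent r turn) ⟩
    lastOr (lastOr (pt r 0) (rowSegment r 0 turn)) (ascent r turn) ≡⟨ cong (λ v → lastOr v (ascent r turn)) lastOr-turn ⟩
    lastOr (pt r turn) (ascent r turn)                     ≡⟨ lastOr-ascent r turn ⟩
    pt 0 (r + turn)                                        ≡⟨ cong (pt 0) r+turn≡s ⟩
    pt 0 s                                                 ∎
    where open ≡-Reasoning

  lastOr-rightDescent : lastOr (pt 0 (suc s)) (descent r 0 (suc s)) ≡ pt r (r + suc s)
  lastOr-rightDescent = trans (lastOr-descent r 0 (suc s)) (cong (λ a → pt a (r + suc s)) (ℕP.+-identityʳ r))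

  rightPart-linked : Linked (λ u v → Step u v × ColumnThen _<_ u v) (pt 0 (suc s) ∷ rightPart)
  rightPart-linked = Linked-++⁺ (pt 0 (suc s)) (descent r 0 (suc s)) (rowSegment r (r + suc s) tail)
    (descent-linked r 0 (suc s) refl) lastOr-rightDescent
    (Linked.map (λ (st , lt) → st , inj₁ lt) (rowSegment-linked (r + suc s) tail))

  lastOr-rightPart : lastOr (pt 0 (suc s)) rightPart ≡ pt r lastColumn
  lastOr-rightPart = trans (lastOr-++ (pt 0 (suc s)) (descent r 0 (suc s)) (rowSegment r (r + suc s) tail))
    (trans (cong (λ v → lastOr v (rowSegment r (r + suc s) tail)) lastOr-rightDescent) (lastOr-rowSegment r (r + suc s) tail))

  lastOr-middle : lastOr (pt r 0) (leftPart ++ pt 0 (suc s) ∷ rightPart) ≡ pt r lastColumn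
  lastOr-middle = trans (lastOr-++ (pt r 0) leftPart (pt 0 (suc s) ∷ rightPart))
    (trans (cong (λ v → lastOr v (pt 0 (suc s) ∷ rightPart)) lastOr-leftPart) lastOr-rightPart)

  route-linked : Linked Step route
  route-linked = (inj₁ (x-arc r) , inj₁ refl)
    ∷ Linked-++⁺ (pt r 0) (leftPart ++ pt 0 (suc s) ∷ rightPart) (Y ∷ [])
        (Linked-++⁺ (pt r 0) leftPart (pt 0 (suc s) ∷ rightPart) (Linked.map proj₁ leftPart-linked) lastOr-leftPart
          ((inj₁ (h-arc 0 s) , inj₂ (inj₂ refl)) ∷ Linked.map proj₁ rightPart-linked))
        lastOr-middle ((inj₁ (y-arc r lastColumn width) , inj₁ refl) ∷ [-])

  s≤lastColumn : suc s ≤ lastColumn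
  s≤lastColumn = ℕP.≤-trans (ℕP.m≤n+m (suc s) r) (ℕP.m≤n+m _ tail)

  leftPart-inBox : All (InBox r 0 s) (pt r 0 ∷ leftPart)
  leftPart-inBox = (ℕP.≤-refl , z≤n , z≤n)
    ∷ AllP.++⁺ (rowSegment-inBox r 0 turn ℕP.≤-refl z≤n (ℕP.≤-trans (ℕP.≤-reflexive (ℕP.+-identityʳ turn)) turn≤s))
               (ascent-inBox r turn ℕP.≤-refl z≤n (ℕP.≤-reflexive r+turn≡s))
    where
    turn≤s : turn ≤ s
    turn≤s = subst (turn ≤_) turn+r (ℕP.m≤m+n turn r)

  rightPart-inBox : All (InBox r (suc s) lastColumn) (pt 0 (suc s) ∷ rightPart)
  rightPart-inBox = (z≤n , ℕP.≤-refl , s≤lastColumn)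
    ∷ AllP.++⁺ (descent-inBox r 0 (suc s) (ℕP.≤-reflexive (ℕP.+-identityʳ r)) ℕP.≤-refl (ℕP.m≤n+m _ tail))
               (rowSegment-inBox r (r + suc s) tail ℕP.≤-refl (ℕP.m≤n⇒m≤1+n (ℕP.m≤n+m (suc s) r)) ℕP.≤-refl)

  middle-inBox : All (InBox r 0 lastColumn) middle
  middle-inBox = AllP.++⁺ (All.map widen leftPart-inBox) (All.map narrow rightPart-inBox)
    where
    widen : ∀ {v} → InBox r 0 s v → InBox r 0 lastColumn v
    widen {pt _ _} (a≤ , _ , b≤s) = a≤ , z≤n , ℕP.≤-trans b≤s (ℕP.≤-trans (ℕP.n≤1+n s) s≤lastColumn)
    narrow : ∀ {v} → InBox r (suc s) lastColumn v → InBox r 0 lastColumn v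
    narrow {pt _ _} (a≤ , _ , b≤) = a≤ , z≤n , b≤

  middle-unique : Unique middle
  middle-unique = UP.++⁺ (Linked⇒Unique {_>_} (flip ℕP.<-trans) (λ {n} → ℕP.n≮n n) (Linked.map proj₂ leftPart-linked))
                         (Linked⇒Unique {_<_} ℕP.<-trans (λ {n} → ℕP.n≮n n) (Linked.map proj₂ rightPart-linked))
                         λ (v∈ˡ , v∈ʳ) → separated (All.lookup leftPart-inBox v∈ˡ) (All.lookup rightPart-inBox v∈ʳ)
    where
    separated : ∀ {v} → InBox r 0 s v → InBox r (suc s) lastColumn v → ⊥
    separated {pt _ _} (_ , _ , b≤s) (_ , s<b , _) = ℕP.<-irrefl refl (ℕP.≤-trans s<b b≤s)

  middle-grid : All (λ v → v ≢ X × v ≢ Y) middle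
  middle-grid = All.map inBox⇒grid middle-inBox

  route-unique : Unique route
  route-unique = AllP.++⁺ (All.map (λ (v≢X , _) X≡v → v≢X (≡.sym X≡v)) middle-grid) ((λ ()) ∷ [])
               ∷ UP.++⁺ middle-unique ([] ∷ []) (λ { (v∈ , here refl) → proj₂ (All.lookup middle-grid v∈) refl })

  route-inGrid : All InGrid route
  route-inGrid = tt ∷ AllP.++⁺ (All.map inGrid middle-inBox) (tt ∷ [])
    where
    inGrid : ∀ {v} → InBox r 0 lastColumn v → InGrid v
    inGrid {pt _ _} (a≤r , _ , b≤) = ℕP.≤-<-trans a≤r r<R , subst (_ <_) width (s≤s b≤)

  row0∈middle : pt 0 (suc s) ∈ middle
  row0∈middle = ∈-++⁺ʳ (pt r 0 ∷ leftPart) (here refl)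

-- The counterexample

module Counterexample (m : ℕ) where

  m₂ m₄ : ℕ
  m₂ = m + m
  m₄ = m₂ + m₂

  -- Odd, as the vertical edges of a staircase require, and at least every row index 1, …, 2m + 1.
  staircase : ℕ → ℕ
  staircase j = suc ((m₂ + j) + (m₂ + j))

  rows columns : ℕ
  rows = suc (suc m₂)
  columns = suc (suc m₂ + suc (staircase m₄))

  open Wall rows columns
  open TwoPaths rows columns

  labels : (Node → Node → ℕ) → List (Fin size × Fin size) → List ℕ
  labels f = concatMap λ (i , j) → f (node i) (node j) ∷ f (node j) (node i) ∷ []

  length-labels : ∀ f Z → length (labels f Z) ≡ length Z + length Z
  length-labels f [] = refl
  length-labels f (_ ∷ Z) = cong suc (trans (cong suc (length-labels f Z)) (≡.sym (ℕP.+-suc (length Z) (length Z))))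

  label∈ : ∀ f {Z z u v} → z ∈ Z → SameEdge (index u , index v) z → InGrid u → InGrid v → f u v ∈ labels f Z
  label∈ f {z = _ , _} {u} {v} z∈ (inj₁ (refl , refl)) gu gv =
    ∈-concatMap⁺ _ z∈ (here (≡.sym (cong₂ f (node-index u gu) (node-index v gv))))
  label∈ f {z = _ , _} {u} {v} z∈ (inj₂ (refl , refl)) gu gv =
    ∈-concatMap⁺ _ z∈ (there (here (≡.sym (cong₂ f (node-index u gu) (node-index v gv)))))

  staircase-injective : ∀ {i j} → staircase i ≡ staircase j → i ≡ j
  staircase-injective {i} {j} eq = ℕP.+-cancelˡ-≡ m₂ i j (double-injective (m₂ + i) (m₂ + j) (ℕP.suc-injective eq))

  staircase-mono : ∀ {i j} → i ≤ j → staircase i ≤ staircase j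
  staircase-mono i≤j = s≤s (ℕP.+-mono-≤ (ℕP.+-monoʳ-≤ m₂ i≤j) (ℕP.+-monoʳ-≤ m₂ i≤j))

  staircaseLabels : List (Fin size × Fin size) → List ℕ
  staircaseLabels Z = labels ascentLabel Z ++ labels descentLabel Z

  module RouteThrough (j₁ j₂ : ℕ) (j₁≤ : j₁ ≤ m₂) (j₂≤ : j₂ ≤ m₄) where

    r q s : ℕ
    r = suc j₁
    q = m₂ + j₂
    s = staircase j₂

    r≤s : r ≤ s
    r≤s = s≤s (ℕP.≤-trans j₁≤ (ℕP.≤-trans (ℕP.m≤m+n m₂ j₂) (ℕP.m≤m+n q q)))

    fits : suc (r + suc s) ≤ columns
    fits = s≤s (ℕP.+-mono-≤ (s≤s j₁≤) (s≤s (staircase-mono j₂≤)))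

    open Route rows columns r q (s ∸ r) (columns ∸ suc (r + suc s)) (ℕP.m∸n+n≡m r≤s) (s≤s (s≤s j₁≤))
               (trans (≡.sym (ℕP.+-suc (columns ∸ suc (r + suc s)) (r + suc s))) (ℕP.m∸n+n≡m fits))
      using (middle; route; route-linked; route-unique; route-inGrid; middle-grid; row0∈middle)

    route-indices : map index route ≡ index X ∷ map index middle ++ index Y ∷ []
    route-indices = cong (index X ∷_) (LP.map-++ index middle (Y ∷ []))

    map-node-index : ∀ {vs} → All InGrid vs → map node (map index vs) ≡ vs
    map-node-index [] = refl
    map-node-index (g ∷ gs) = cong₂ _∷_ (node-index _ g) (map-node-index gs)

    routePath : Path wall
    routePath = record
      { start = index X ; inner = map index middle ; end = index Y
      ; linked = subst (Linked (Adj wall)) route-indices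
          (LinkedP.map⁺ (Linked-map-All (λ (e , _) gu gv → edge⇒adj e gu gv) route-linked route-inGrid))
      ; unique = subst Unique route-indices (UP.map⁻ (subst Unique (≡.sym (map-node-index route-inGrid)) route-unique))
      }

    routePath-aba : IsABAPath A B routePath
    routePath-aba = (∈-tabulate⁺ (isTerminal ∘ node) refl , ∈-tabulate⁺ (isTerminal ∘ node) refl
                    , AllP.map⁺ (All.zipWith nonTerminal (middle-grid , middle-inGrid)))
                  , Any.map (λ { refl → row0∈B }) (there (∈-++⁺ˡ (∈-map⁺ index row0∈middle)))
      where
      middle-inGrid : All InGrid middle
      middle-inGrid = AllP.++⁻ˡ middle (All.tail route-inGrid)
      nonTerminal : ∀ {v} → (v ≢ X × v ≢ Y) × InGrid v → index v Sub.∉ A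
      nonTerminal ((v≢X , v≢Y) , g) v∈A with terminal⇒X⊎Y v∈A
      ... | inj₁ isX = v≢X (trans (≡.sym (node-index _ g)) isX)
      ... | inj₂ isY = v≢Y (trans (≡.sym (node-index _ g)) isY)
      row0∈B : index (pt 0 (suc s)) Sub.∈ B
      row0∈B = ∈-tabulate⁺ (inRow0 ∘ node) (cong inRow0 (node-index _ (All.lookup route-inGrid (there (∈-++⁺ˡ row0∈middle)))))

    routePath-avoids : ∀ Z → r ∉ labels rowLabel Z → s ∉ staircaseLabels Z →
                       ∀ {e z} → e ∈ edgesOf routePath → z ∈ Z → ¬ SameEdge e z
    routePath-avoids Z r∉ s∉ {e} e∈ z∈ same
      with ∈-map⁻ (Product.map index index)
             (subst (e ∈_) (consecutive-map index route) (subst (λ vs → e ∈ consecutive vs) (≡.sym route-indices) e∈))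
    ... | (u , v) , uv∈ , refl with ∈-consecutive⇒∈ route uv∈ | proj₂ (Linked⇒consecutive route-linked uv∈)
    ... | u∈ , v∈ | labelled = blocked labelled
      where
      gu = All.lookup route-inGrid u∈
      gv = All.lookup route-inGrid v∈
      blocked : Labelled r s u v → ⊥
      blocked (inj₁ eq) = r∉ (subst (_∈ _) eq (label∈ rowLabel z∈ same gu gv))
      blocked (inj₂ (inj₁ eq)) = s∉ (subst (_∈ staircaseLabels Z) eq (∈-++⁺ˡ (label∈ ascentLabel z∈ same gu gv)))
      blocked (inj₂ (inj₂ eq)) =
        s∉ (subst (_∈ staircaseLabels Z) eq (∈-++⁺ʳ (labels ascentLabel Z) (label∈ descentLabel z∈ same gu gv)))

    escapes : ∀ Z → r ∉ labels rowLabel Z → s ∉ staircaseLabels Z →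
              ¬ (∀ P → IsABAPath A B P → ∃[ e ] ∃[ z ] (e ∈ edgesOf P × z ∈ Z × SameEdge e z))
    escapes Z r∉ s∉ hits with hits routePath routePath-aba
    ... | e , z , e∈ , z∈ , same = routePath-avoids Z r∉ s∉ e∈ z∈ same

  fewRowLabels : ∀ Z → length Z ≤ m → length (labels rowLabel Z) ≤ m₂
  fewRowLabels Z |Z|≤m = subst (_≤ m₂) (≡.sym (length-labels rowLabel Z)) (ℕP.+-mono-≤ |Z|≤m |Z|≤m)

  fewStaircaseLabels : ∀ Z → length Z ≤ m → length (staircaseLabels Z) ≤ m₄
  fewStaircaseLabels Z |Z|≤m = subst (_≤ m₄) (≡.sym length-staircaseLabels) (ℕP.+-mono-≤ twice≤ twice≤)
    where
    twice≤ = ℕP.+-mono-≤ |Z|≤m |Z|≤m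
    length-staircaseLabels = trans (LP.length-++ (labels ascentLabel Z))
      (cong₂ _+_ (length-labels ascentLabel Z) (length-labels descentLabel Z))

  ¬smallHittingSet : ¬ HasSmallHittingEdgeSet wall A B m
  ¬smallHittingSet (Z , _ , |Z|≤m , hits)
    with ∃-unlisted suc ℕP.suc-injective m₂ (labels rowLabel Z) (fewRowLabels Z |Z|≤m)
       | ∃-unlisted staircase staircase-injective m₄ (staircaseLabels Z) (fewStaircaseLabels Z |Z|≤m)
  ... | j₁ , j₁≤ , r∉ | j₂ , j₂≤ , s∉ = RouteThrough.escapes j₁ j₂ j₁≤ j₂≤ Z r∉ s∉ hits

  counterexample : ¬ (HasDisjointABAPaths wall A B 2 ⊎ HasSmallHittingEdgeSet wall A B m)
  counterexample (inj₁ twoPaths) = ¬twoDisjointABAPaths twoPaths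
  counterexample (inj₂ hittingSet) = ¬smallHittingSet hittingSet

mainTheorem9 : ¬ Σ (ℕ → ℕ) (λ f → ∀ (k : ℕ) → 1 ≤ k → ∀ (G : Graph) (A B : Subset (n G)) → HasDisjointABAPaths G A B k ⊎ HasSmallHittingEdgeSet G A B (f k))
mainTheorem9 (f , bound) = Counterexample.counterexample (f 2) (bound 2 (s≤s z≤n) _ _ _)
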